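{- Let $\mathcal A$ be a class of powerset modal algebras over a finite alphabet $\mathrm{Al}$. Then the logic $\mathrm{Log}(\mathcal A)$ is locally tabular if and only if $\mathcal A$ is uniformly tunable.
   Context: A powerset $\mathrm{Al}$-algebra is $C=(\mathcal P(X),(g_\Diamond)_{\Diamond\in\mathrm{Al}})$ where each $g_\Diamond:\mathcal P(X)\to\mathcal P(X)$ satisfies $g_\Diamond(\emptyset)=\emptyset$ and $g_\Diamond(U\cup V)=g_\Diamond(U)\cup g_\Diamond(V)$. A formula $\varphi$ is valid in $C$ if $\varphi=X$ under every assignment of subsets to variables ($\Diamond$ interpreted as $g_\Diamond$); $\mathrm{Log}(\mathcal A)$ is the set of formulas valid in all members of $\mathcal A$. A logic is locally tabular if for every $k<\omega$ there are only finitely many pairwise nonequivalent (in the logic) formulas in variables $p_0,\dots,p_{k-1}$. A partition $\mathcal U$ of $X$ is $g$-tuned if for all $U,V\in\mathcal U$: if $V\cap g(U)\neq\emptyset$ then $V\subseteq g(U)$; it is tuned in $C$ if it is $g_\Diamond$-tuned for every $\Diamond$. For $f:\omega\to\omega$, $\mathcal A$ is $f$-tunable if for every $C=(\mathcal P(X),(g_\Diamond))\in\mathcal A$ and every finite partition $\mathcal V$ of $X$ there is a refinement $\mathcal U$ of $\mathcal V$ with $|\mathcal U|\le f(|\mathcal V|)$ that is tuned in $C$; $\mathcal A$ is uniformly tunable if it is $f$-tunable for some $f$. -}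

module Defs where

open import Level using (Level; _⊔_) renaming (suc to lsuc; zero to lzero)
open import Data.Nat using (ℕ; _≤_)
open import Data.Fin using (Fin; _≟_)
open import Data.Bool using (Bool; true; false; _∨_; not)
open import Data.List using (List)
open import Data.List.Membership.Propositional using (_∈_)
open import Data.Product using (Σ; ∃; _×_; _,_)
open import Relation.Nullary.Decidable using (⌊_⌋)
open import Relation.Binary.PropositionalEquality using (_≡_)

-- Subsets of X are represented by characteristic functions X → Bool;
-- equality of subsets is pointwise equality.
Sub : Set → Set
Sub X = X → Bool

∅ : {X : Set} → Sub X
∅ _ = false

_∪_ : {X : Set} → Sub X → Sub X → Sub X
(U ∪ V) x = U x ∨ V x

_≐_ : {X : Set} → Sub X → Sub X → Set
U ≐ V = ∀ x → U x ≡ V x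

record PowAlg (n : ℕ) : Set₁ where
  field
    X      : Set
    g      : Fin n → Sub X → Sub X
    -- g is a well-defined operation on P(X) (respects equality of subsets)
    g-cong : ∀ i {U V : Sub X} → U ≐ V → g i U ≐ g i V
    g-∅    : ∀ i → g i ∅ ≐ ∅
    g-∪    : ∀ i (U V : Sub X) → g i (U ∪ V) ≐ (g i U ∪ g i V)

data Fm (n : ℕ) (Var : Set) : Set where
  var  : Var → Fm n Var
  ⊥'   : Fm n Var
  _⇒_  : Fm n Var → Fm n Var → Fm n Var
  ◇    : Fin n → Fm n Var → Fm n Var

infixr 5 _⇒_

¬' : ∀ {n Var} → Fm n Var → Fm n Var
¬' φ = φ ⇒ ⊥'

_∧'_ : ∀ {n Var} → Fm n Var → Fm n Var → Fm n Var
φ ∧' ψ = ¬' (φ ⇒ ¬' ψ)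

_⇔'_ : ∀ {n Var} → Fm n Var → Fm n Var → Fm n Var
φ ⇔' ψ = (φ ⇒ ψ) ∧' (ψ ⇒ φ)

⟦_⟧ : ∀ {n Var} → Fm n Var → (C : PowAlg n) → (Var → Sub (PowAlg.X C)) → Sub (PowAlg.X C)
⟦ var v ⟧ C val = val v
⟦ ⊥' ⟧ C val = ∅
⟦ φ ⇒ ψ ⟧ C val x = not (⟦ φ ⟧ C val x) ∨ ⟦ ψ ⟧ C val x
⟦ ◇ i φ ⟧ C val = PowAlg.g C i (⟦ φ ⟧ C val)

ValidIn : ∀ {n Var} → PowAlg n → Fm n Var → Set
ValidIn C φ = ∀ val → ⟦ φ ⟧ C val ≐ (λ _ → true)

Class : ∀ (ℓ : Level) → ℕ → Set (lsuc lzero ⊔ lsuc ℓ)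
Class ℓ n = PowAlg n → Set ℓ

_∈Log_ : ∀ {ℓ n Var} → Fm n Var → Class ℓ n → Set (lsuc lzero ⊔ ℓ)
φ ∈Log 𝒜 = ∀ C → 𝒜 C → ValidIn C φ

LocallyTabular : ∀ {ℓ n} → Class ℓ n → Set (lsuc lzero ⊔ ℓ)
LocallyTabular {n = n} 𝒜 =
  ∀ (k : ℕ) → Σ (List (Fm n (Fin k))) λ L →
    ∀ (φ : Fm n (Fin k)) → Σ (Fm n (Fin k)) λ ψ → ψ ∈ L × ((φ ⇔' ψ) ∈Log 𝒜)

record Partition (X : Set) : Set where
  field
    size : ℕ
    blk  : X → Fin size
    surj : ∀ (i : Fin size) → ∃ λ x → blk x ≡ i

block : ∀ {X} (P : Partition X) → Fin (Partition.size P) → Sub X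
block P i x = ⌊ Partition.blk P x ≟ i ⌋

_Refines_ : ∀ {X} → Partition X → Partition X → Set
𝒰 Refines 𝒱 = ∀ x y → Partition.blk 𝒰 x ≡ Partition.blk 𝒰 y →
                       Partition.blk 𝒱 x ≡ Partition.blk 𝒱 y

Tuned-by : ∀ {X} → (Sub X → Sub X) → Partition X → Set
Tuned-by g 𝒰 = ∀ (u v : Fin (Partition.size 𝒰)) →
  (∃ λ x → block 𝒰 v x ≡ true × g (block 𝒰 u) x ≡ true) →
  ∀ y → block 𝒰 v y ≡ true → g (block 𝒰 u) y ≡ true

TunedIn : ∀ {n} (C : PowAlg n) → Partition (PowAlg.X C) → Set
TunedIn C 𝒰 = ∀ i → Tuned-by (PowAlg.g C i) 𝒰

_-Tunable : ∀ {ℓ n} → (ℕ → ℕ) → Class ℓ n → Set (lsuc lzero ⊔ ℓ)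
(f -Tunable) 𝒜 = ∀ C → 𝒜 C → ∀ (𝒱 : Partition (PowAlg.X C)) →
  Σ (Partition (PowAlg.X C)) λ 𝒰 →
    (𝒰 Refines 𝒱) × (Partition.size 𝒰 ≤ f (Partition.size 𝒱)) × TunedIn C 𝒰

UniformlyTunable : ∀ {ℓ n} → Class ℓ n → Set (lsuc lzero ⊔ ℓ)
UniformlyTunable 𝒜 = Σ (ℕ → ℕ) λ f → (f -Tunable) 𝒜

{-# OPTIONS --safe #-}
module Submission where

-- If Log(𝒜) is locally tabular and 𝒱 is a partition with k blocks, read the blocks as
-- k variables and let ψ₁ … ψ_N represent all formulas in them up to equivalence.  The
-- atoms of ⟦ψ₁⟧ … ⟦ψ_N⟧ form a refinement 𝒰 of 𝒱 with at most 2^N blocks; every formula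
-- denotes a union of blocks, and each block u is defined by a formula χ_u, so
-- g(u) = ⟦◇ χ_u⟧ is a union of blocks as well: 𝒰 is tuned.
--
-- Conversely, if 𝒜 is f-tunable, a valuation of k variables in C ∈ 𝒜 partitions C into at
-- most 2^k types, which has a tuned refinement with at most m = max_{j ≤ 2^k} f j blocks.
-- Tunedness makes the blocks a finite Kripke model satisfying the same formulas (a
-- filtration), so formulas with the same truth table on the finitely many pointed models
-- of size ≤ m are equivalent in Log(𝒜).  Excluded middle is used to discard empty blocks
-- and to choose one formula for each attained truth table.

open import Defs
open import Level using (Level; 0ℓ)
open import Data.Nat using (ℕ; zero; suc; _≤_; s≤s; _^_)
open import Data.Nat.Properties using (≤-trans; ≤-reflexive)
open import Data.Bool using (Bool; true; false; _∧_; _∨_; not)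
open import Data.Bool.Properties using (⇔→≡; ∧-conicalˡ; ∧-conicalʳ; ∨-zeroʳ; T-≡)
open import Data.Fin using (Fin; zero; suc; funToFin; finToFun; combine) renaming (_≟_ to _≟ᶠ_)
open import Data.Fin.Properties using (finToFun-funToFin)
open import Data.List
  using (List; []; _∷_; length; lookup; map; filter; allFin; upTo; concatMap; cartesianProductWith)
open import Data.List.Properties using (length-filter; length-tabulate)
open import Data.List.Extrema.Nat using (max; xs≤max)
open import Data.List.Membership.Propositional using (_∈_)
open import Data.List.Membership.Propositional.Properties
  using (∈-allFin; ∈-filter⁺; ∈-filter⁻; ∈-lookup; ∈-map⁺; ∈-concat⁺′; ∈-cartesianProductWith⁺; ∈-upTo⁺)
open import Data.List.Membership.Setoid.Properties using (index-injective; unique⇒irrelevant)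
open import Data.List.Relation.Unary.All as All using ()
open import Data.List.Relation.Unary.Any using (here; there; index)
open import Data.List.Relation.Unary.Any.Properties using (lookup-index)
open import Data.List.Relation.Unary.Unique.Propositional.Properties using (filter⁺; allFin⁺)
open import Data.Vec using (Vec; tabulate) renaming ([] to []ᵥ; _∷_ to _∷ᵥ_; lookup to lookupᵥ)
open import Data.Vec.Properties using (lookup∘tabulate)
open import Data.Product using (Σ; ∃; _×_; _,_; proj₁; proj₂)
open import Data.Empty using (⊥-elim)
open import Function using (_∘_)
open import Function.Bundles using (_⇔_; mk⇔; Equivalence)
open import Function.Properties.Equivalence using () renaming (trans to ⇔-trans)
open import Axiom.ExcludedMiddle using (ExcludedMiddle)
open import Axiom.UniquenessOfIdentityProofs using (module Decidable⇒UIP)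
open import Relation.Nullary.Decidable using (Dec; yes; no; toWitness; fromWitness)
open import Relation.Binary.PropositionalEquality

⋁ : ∀ {s} → (Fin s → Bool) → Bool
⋁ {zero}  p = false
⋁ {suc s} p = p zero ∨ ⋁ (p ∘ suc)

⋁-cong : ∀ {s} {p q : Fin s → Bool} → p ≗ q → ⋁ p ≡ ⋁ q
⋁-cong {zero}  _   = refl
⋁-cong {suc s} p≗q = cong₂ _∨_ (p≗q zero) (⋁-cong (p≗q ∘ suc))

⋁-true⁺ : ∀ {s} (p : Fin s → Bool) {u} → p u ≡ true → ⋁ p ≡ true
⋁-true⁺ p {zero}  pu rewrite pu = refl
⋁-true⁺ p {suc u} pu = trans (cong (p zero ∨_) (⋁-true⁺ (p ∘ suc) pu)) (∨-zeroʳ (p zero))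

⋁-true⁻ : ∀ {s} (p : Fin s → Bool) → ⋁ p ≡ true → ∃ λ u → p u ≡ true
⋁-true⁻ {suc s} p h with p zero in p0
... | true  = zero , p0
... | false = let u , pu = ⋁-true⁻ (p ∘ suc) h in suc u , pu

bit : Bool → Fin 2
bit false = zero
bit true  = suc zero

bit-injective : ∀ {a b} → bit a ≡ bit b → a ≡ b
bit-injective {false} {false} _ = refl
bit-injective {true}  {true}  _ = refl

funToFin-cong : ∀ {m n} {f h : Fin m → Fin n} → f ≗ h → funToFin f ≡ funToFin h
funToFin-cong {zero}  _   = refl
funToFin-cong {suc m} f≗h = cong₂ combine (f≗h zero) (funToFin-cong (f≗h ∘ suc))

encode : ∀ {N} → (Fin N → Bool) → Fin (2 ^ N)
encode s = funToFin (bit ∘ s)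

encode≡⇔ : ∀ {N} {s t : Fin N → Bool} → encode s ≡ encode t ⇔ s ≗ t
encode≡⇔ {s = s} {t} = mk⇔ injective (λ s≗t → funToFin-cong (cong bit ∘ s≗t))
  where
  open ≡-Reasoning
  injective : encode s ≡ encode t → s ≗ t
  injective e i = bit-injective (begin
    bit (s i)                        ≡⟨ finToFun-funToFin (bit ∘ s) i ⟨
    finToFun (funToFin (bit ∘ s)) i  ≡⟨ cong (λ c → finToFun c i) e ⟩
    finToFun (funToFin (bit ∘ t)) i  ≡⟨ finToFun-funToFin (bit ∘ t) i ⟩
    bit (t i)                        ∎)

finiteTransversal : ExcludedMiddle 0ℓ → ∀ {A : Set} {c} (t : A → Fin c) →
  Σ (List A) λ L → ∀ a → Σ A λ b → b ∈ L × t a ≡ t b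
finiteTransversal em {A} {c} t = concatMap (witness ∘ attained?) (allFin c) , covered
  where
  attained? : ∀ i → Dec (∃ λ a → t a ≡ i)
  attained? i = em

  witness : ∀ {i} → Dec (∃ λ a → t a ≡ i) → List A
  witness (yes (a , _)) = a ∷ []
  witness (no _)        = []

  witness-attains : ∀ {i} (d : Dec (∃ λ a → t a ≡ i)) → ∃ (λ a → t a ≡ i) →
    Σ A λ b → b ∈ witness d × t b ≡ i
  witness-attains (yes (b , tb≡i)) _ = b , here refl , tb≡i
  witness-attains (no ∄) ∃a          = ⊥-elim (∄ ∃a)

  covered : ∀ a → Σ A λ b → b ∈ concatMap (witness ∘ attained?) (allFin c) × t a ≡ t b
  covered a with b , b∈ , tb≡ta ← witness-attains (attained? (t a)) (a , refl) =
    b , ∈-concat⁺′ b∈ (∈-map⁺ (witness ∘ attained?) (∈-allFin (t a))) , sym tb≡ta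

module _ {X : Set} (P : Partition X) where
  open Partition P

  block≡true⇔ : ∀ {i x} → block P i x ≡ true ⇔ blk x ≡ i
  block≡true⇔ {i} {x} = mk⇔ (λ h → toWitness {a? = blk x ≟ᶠ i} (Equivalence.from T-≡ h))
                            (λ e → Equivalence.to T-≡ (fromWitness e))

  block-blk : ∀ x → block P (blk x) x ≡ true
  block-blk x = Equivalence.from block≡true⇔ refl

  representative : Fin size → X
  representative u = proj₁ (surj u)

  blk-representative : ∀ u → blk (representative u) ≡ u
  blk-representative u = proj₂ (surj u)

  Saturated : Sub X → Set
  Saturated U = ∀ {x y} → blk x ≡ blk y → U x ≡ U y

  saturated-representative : ∀ {U} → Saturated U → ∀ x → U x ≡ U (representative (blk x))
  saturated-representative sat x = sat (sym (blk-representative (blk x)))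

  saturated-⋁ : (h : Fin size → Bool) → (λ y → h (blk y)) ≐ λ y → ⋁ λ u → h u ∧ block P u y
  saturated-⋁ h y = ⇔→≡ (mk⇔
    (λ hy → ⋁-true⁺ (λ u → h u ∧ block P u y) (cong₂ _∧_ hy (block-blk y)))
    (λ ⋁≡true → let u , hu∧y∈u = ⋁-true⁻ (λ u → h u ∧ block P u y) ⋁≡true
                in  trans (cong h (Equivalence.to block≡true⇔ (∧-conicalʳ (h u) _ hu∧y∈u)))
                          (∧-conicalˡ (h u) _ hu∧y∈u)))

  tuned⇔saturated : (g : Sub X → Sub X) → Tuned-by g P ⇔ (∀ u → Saturated (g (block P u)))
  tuned⇔saturated g = mk⇔ saturated tuned
    where
    saturated : Tuned-by g P → ∀ u → Saturated (g (block P u))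
    saturated t u {x} {y} e = ⇔→≡ (mk⇔
      (λ gx → t u (blk y) (x , Equivalence.from block≡true⇔ e , gx) y (block-blk y))
      (λ gy → t u (blk x) (y , Equivalence.from block≡true⇔ (sym e) , gy) x (block-blk x)))

    tuned : (∀ u → Saturated (g (block P u))) → Tuned-by g P
    tuned s u v (x , vx , gx) y vy =
      trans (s u (trans (Equivalence.to block≡true⇔ vy) (sym (Equivalence.to block≡true⇔ vx)))) gx

saturated-blocks⇒refines : ∀ {X} (𝒰 𝒱 : Partition X) → (∀ j → Saturated 𝒰 (block 𝒱 j)) → 𝒰 Refines 𝒱
saturated-blocks⇒refines 𝒰 𝒱 sat x y e =
  sym (Equivalence.to (block≡true⇔ 𝒱) (trans (sym (sat (Partition.blk 𝒱 x) e)) (block-blk 𝒱 x)))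

record PartitionOf {X : Set} (_~_ : X → X → Set) (c : ℕ) : Set where
  field
    partition   : Partition X
    size≤       : Partition.size partition ≤ c
    same-block⇔ : ∀ {x y} → Partition.blk partition x ≡ Partition.blk partition y ⇔ x ~ y

index-∈-lookup : ∀ {A : Set} (xs : List A) i → index (∈-lookup {xs = xs} i) ≡ i
index-∈-lookup (x ∷ xs) zero    = refl
index-∈-lookup (x ∷ xs) (suc i) = cong suc (index-∈-lookup xs i)

module _ (em : ExcludedMiddle 0ℓ) where

  kernelPartition : ∀ {X : Set} {c} (b : X → Fin c) → PartitionOf (λ x y → b x ≡ b y) c
  kernelPartition {X} {c} b = record
    { partition   = record { size = length image ; blk = λ x → index (b∈image x) ; surj = surj }
    ; size≤       = ≤-trans (length-filter attained? (allFin c)) (≤-reflexive (length-tabulate _))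
    ; same-block⇔ = mk⇔ (index-injective (setoid (Fin c)) _ _) (index-cong _ _)
    }
    where
    attained? : ∀ i → Dec (∃ λ x → b x ≡ i)
    attained? i = em

    image : List (Fin c)
    image = filter attained? (allFin c)

    b∈image : ∀ x → b x ∈ image
    b∈image x = ∈-filter⁺ attained? (∈-allFin (b x)) (x , refl)

    index-cong : ∀ {i j} (p : i ∈ image) (q : j ∈ image) → i ≡ j → index p ≡ index q
    index-cong p q refl = cong index (unique⇒irrelevant (setoid (Fin c))
      (Decidable⇒UIP.≡-irrelevant _≟ᶠ_) (filter⁺ attained? (allFin⁺ c)) p q)

    surj : ∀ j → ∃ λ x → index (b∈image x) ≡ j
    surj j with x , bx≡ ← proj₂ (∈-filter⁻ attained? {xs = allFin c} (∈-lookup {xs = image} j)) =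
      x , trans (index-cong _ _ bx≡) (index-∈-lookup image j)

  atoms : ∀ {X : Set} {N} (S : Fin N → Sub X) → PartitionOf (λ x y → ∀ i → S i x ≡ S i y) (2 ^ N)
  atoms S = record { partition = partition ; size≤ = size≤ ; same-block⇔ = ⇔-trans same-block⇔ encode≡⇔ }
    where open PartitionOf (kernelPartition (λ x → encode λ i → S i x))

module _ {n} (C : PowAlg n) where
  open PowAlg C

  g-⋁ : ∀ i {s} (P : Fin s → Sub X) → g i (λ y → ⋁ λ u → P u y) ≐ λ x → ⋁ λ u → g i (P u) x
  g-⋁ i {zero}  P   = g-∅ i
  g-⋁ i {suc s} P x = trans (g-∪ i (P zero) _ x) (cong (g i (P zero) x ∨_) (g-⋁ i (P ∘ suc) x))

  g-∧-const : ∀ i b (U : Sub X) → g i (λ y → b ∧ U y) ≐ λ x → b ∧ g i U x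
  g-∧-const i true  U x = refl
  g-∧-const i false U   = g-∅ i

module Semantics {n} {Var : Set} (C : PowAlg n) (val : Var → Sub (PowAlg.X C)) where

  ⟦⇔'⟧≡true⇔ : ∀ φ ψ x → ⟦ φ ⇔' ψ ⟧ C val x ≡ true ⇔ ⟦ φ ⟧ C val x ≡ ⟦ ψ ⟧ C val x
  ⟦⇔'⟧≡true⇔ φ ψ x with ⟦ φ ⟧ C val x | ⟦ ψ ⟧ C val x
  ... | true  | true  = mk⇔ (λ _ → refl) (λ _ → refl)
  ... | false | false = mk⇔ (λ _ → refl) (λ _ → refl)
  ... | true  | false = mk⇔ (λ ()) (λ ())
  ... | false | true  = mk⇔ (λ ()) (λ ())

  ⟦∧'⟧ : ∀ φ ψ x → ⟦ φ ∧' ψ ⟧ C val x ≡ ⟦ φ ⟧ C val x ∧ ⟦ ψ ⟧ C val x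
  ⟦∧'⟧ φ ψ x with ⟦ φ ⟧ C val x | ⟦ ψ ⟧ C val x
  ... | true  | true  = refl
  ... | true  | false = refl
  ... | false | _     = refl

  literal : Fm n Var → Bool → Fm n Var
  literal φ true  = φ
  literal φ false = ¬' φ

  ⟦literal⟧≡true⇔ : ∀ φ b x → ⟦ literal φ b ⟧ C val x ≡ true ⇔ ⟦ φ ⟧ C val x ≡ b
  ⟦literal⟧≡true⇔ φ true  x = mk⇔ (λ h → h) (λ h → h)
  ⟦literal⟧≡true⇔ φ false x with ⟦ φ ⟧ C val x
  ... | true  = mk⇔ (λ ()) (λ ())
  ... | false = mk⇔ (λ _ → refl) (λ _ → refl)

  characteristic : ∀ {N} → (Fin N → Fm n Var) → (Fin N → Bool) → Fm n Var
  characteristic {zero}  ψ bs = ¬' ⊥'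
  characteristic {suc N} ψ bs = literal (ψ zero) (bs zero) ∧' characteristic (ψ ∘ suc) (bs ∘ suc)

  ⟦characteristic⟧≡true⇔ : ∀ {N} (ψ : Fin N → Fm n Var) bs x →
    ⟦ characteristic ψ bs ⟧ C val x ≡ true ⇔ (∀ i → ⟦ ψ i ⟧ C val x ≡ bs i)
  ⟦characteristic⟧≡true⇔ {zero}  ψ bs x = mk⇔ (λ _ ()) (λ _ → refl)
  ⟦characteristic⟧≡true⇔ {suc N} ψ bs x = mk⇔ to from
    where
    head tail : Fm n Var
    head = literal (ψ zero) (bs zero)
    tail = characteristic (ψ ∘ suc) (bs ∘ suc)

    to : ⟦ head ∧' tail ⟧ C val x ≡ true → ∀ i → ⟦ ψ i ⟧ C val x ≡ bs i
    to h i with trans (sym (⟦∧'⟧ head tail x)) h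
    to h zero    | h' = Equivalence.to (⟦literal⟧≡true⇔ (ψ zero) (bs zero) x) (∧-conicalˡ _ _ h')
    to h (suc i) | h' = Equivalence.to (⟦characteristic⟧≡true⇔ (ψ ∘ suc) (bs ∘ suc) x) (∧-conicalʳ _ _ h') i

    from : (∀ i → ⟦ ψ i ⟧ C val x ≡ bs i) → ⟦ head ∧' tail ⟧ C val x ≡ true
    from h = trans (⟦∧'⟧ head tail x) (cong₂ _∧_
      (Equivalence.from (⟦literal⟧≡true⇔ (ψ zero) (bs zero) x) (h zero))
      (Equivalence.from (⟦characteristic⟧≡true⇔ (ψ ∘ suc) (bs ∘ suc) x) (h ∘ suc)))

allVec : ∀ {A : Set} → List A → ∀ m → List (Vec A m)
allVec as zero    = []ᵥ ∷ []
allVec as (suc m) = cartesianProductWith _∷ᵥ_ as (allVec as m)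

∈-allVec : ∀ {A : Set} {as : List A} → (∀ a → a ∈ as) → ∀ {m} (v : Vec A m) → v ∈ allVec as m
∈-allVec as-complete []ᵥ      = here refl
∈-allVec as-complete (a ∷ᵥ v) = ∈-cartesianProductWith⁺ _∷ᵥ_ (as-complete a) (∈-allVec as-complete v)

bools : List Bool
bools = true ∷ false ∷ []

∈-bools : ∀ b → b ∈ bools
∈-bools true  = here refl
∈-bools false = there (here refl)

-- Kripke models on Fin s, stored as Boolean matrices so that all models of a size can be listed.
record Model (n k s : ℕ) : Set where
  constructor model
  field
    relation  : Vec (Vec (Vec Bool s) s) n
    valuation : Vec (Vec Bool s) k

  R : Fin n → Fin s → Fin s → Bool
  R i w u = lookupᵥ (lookupᵥ (lookupᵥ relation i) w) u

  V : Fin k → Fin s → Bool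
  V j w = lookupᵥ (lookupᵥ valuation j) w

module _ {n k : ℕ} where

  eval : ∀ {s} → Model n k s → Fm n (Fin k) → Fin s → Bool
  eval M (var j) w = Model.V M j w
  eval M ⊥'      w = false
  eval M (φ ⇒ ψ) w = not (eval M φ w) ∨ eval M ψ w
  eval M (◇ i φ) w = ⋁ λ u → eval M φ u ∧ Model.R M i w u

  PointedModel : Set
  PointedModel = Σ ℕ λ s → Model n k s × Fin s

  evalᵖ : Fm n (Fin k) → PointedModel → Bool
  evalᵖ φ (s , M , w) = eval M φ w

  allModels : ∀ s → List (Model n k s)
  allModels s =
    cartesianProductWith model (allVec (allVec (allVec bools s) s) n) (allVec (allVec bools s) k)

  ∈-allModels : ∀ {s} (M : Model n k s) → M ∈ allModels s
  ∈-allModels (model r v) = ∈-cartesianProductWith⁺ model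
    (∈-allVec (∈-allVec (∈-allVec ∈-bools)) r) (∈-allVec (∈-allVec ∈-bools) v)

  pointedModelsUpTo : ℕ → List PointedModel
  pointedModelsUpTo m =
    concatMap (λ s → cartesianProductWith (λ M w → s , M , w) (allModels s) (allFin s)) (upTo (suc m))

  ∈-pointedModelsUpTo : ∀ {s m} → s ≤ m → (M : Model n k s) (w : Fin s) →
    (s , M , w) ∈ pointedModelsUpTo m
  ∈-pointedModelsUpTo {s} s≤m M w = ∈-concat⁺′
    (∈-cartesianProductWith⁺ (λ M w → s , M , w) (∈-allModels M) (∈-allFin w))
    (∈-map⁺ _ (∈-upTo⁺ (s≤s s≤m)))

module _ {n k} (C : PowAlg n) (𝒰 : Partition (PowAlg.X C)) (val : Fin k → Sub (PowAlg.X C)) where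
  open PowAlg C
  open Partition 𝒰

  quotient : Model n k size
  quotient = model (tabulate λ i → tabulate λ w → tabulate λ u → g i (block 𝒰 u) (representative 𝒰 w))
                   (tabulate λ j → tabulate λ w → val j (representative 𝒰 w))

  R-quotient : ∀ i w u → Model.R quotient i w u ≡ g i (block 𝒰 u) (representative 𝒰 w)
  R-quotient i w u = trans (cong (λ r → lookupᵥ (lookupᵥ r w) u) (lookup∘tabulate _ i))
                    (trans (cong (λ r → lookupᵥ r u) (lookup∘tabulate _ w)) (lookup∘tabulate _ u))

  V-quotient : ∀ j w → Model.V quotient j w ≡ val j (representative 𝒰 w)
  V-quotient j w = trans (cong (λ v → lookupᵥ v w) (lookup∘tabulate _ j)) (lookup∘tabulate _ w)

  quotient-truth : TunedIn C 𝒰 → (∀ j → Saturated 𝒰 (val j)) →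
    ∀ φ x → ⟦ φ ⟧ C val x ≡ eval quotient φ (blk x)
  quotient-truth tuned val-saturated = truth
    where
    open ≡-Reasoning

    truth : ∀ φ x → ⟦ φ ⟧ C val x ≡ eval quotient φ (blk x)
    truth (var j) x = trans (saturated-representative 𝒰 (val-saturated j) x) (sym (V-quotient j (blk x)))
    truth ⊥'      x = refl
    truth (φ ⇒ ψ) x = cong₂ (λ a b → not a ∨ b) (truth φ x) (truth ψ x)
    truth (◇ i φ) x = begin
      g i (⟦ φ ⟧ C val) x                        ≡⟨ g-cong i (λ y → trans (truth φ y) (saturated-⋁ 𝒰 h y)) x ⟩
      g i (λ y → ⋁ λ u → h u ∧ block 𝒰 u y) x    ≡⟨ g-⋁ C i (λ u y → h u ∧ block 𝒰 u y) x ⟩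
      (⋁ λ u → g i (λ y → h u ∧ block 𝒰 u y) x)  ≡⟨ ⋁-cong (λ u → g-∧-const C i (h u) (block 𝒰 u) x) ⟩
      (⋁ λ u → h u ∧ g i (block 𝒰 u) x)          ≡⟨ ⋁-cong (λ u → cong (h u ∧_) (edge u)) ⟩
      eval quotient (◇ i φ) (blk x)              ∎
      where
      h : Fin size → Bool
      h = eval quotient φ

      edge : ∀ u → g i (block 𝒰 u) x ≡ Model.R quotient i (blk x) u
      edge u = trans (saturated-representative 𝒰 (Equivalence.to (tuned⇔saturated 𝒰 (g i)) (tuned i) u) x)
                     (sym (R-quotient i (blk x) u))

module LocallyTabular⇒Tunable (em : ExcludedMiddle 0ℓ) {ℓ n} {𝒜 : Class ℓ n}
  (lt : LocallyTabular 𝒜) where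

  tabularity : ℕ → ℕ
  tabularity k = 2 ^ length (proj₁ (lt k))

  module _ (C : PowAlg n) (C∈𝒜 : 𝒜 C) (𝒱 : Partition (PowAlg.X C)) where
    open PowAlg C
    open Semantics C (block 𝒱)

    k : ℕ
    k = Partition.size 𝒱

    L : List (Fm n (Fin k))
    L = proj₁ (lt k)

    ⟦_⟧ᶜ : Fm n (Fin k) → Sub X
    ⟦ φ ⟧ᶜ = ⟦ φ ⟧ C (block 𝒱)

    open PartitionOf (atoms em (λ i → ⟦ lookup L i ⟧ᶜ)) renaming (partition to 𝒰)

    listed-saturated : ∀ {ψ} → ψ ∈ L → Saturated 𝒰 ⟦ ψ ⟧ᶜ
    listed-saturated ψ∈L {x} {y} e =
      subst (λ χ → ⟦ χ ⟧ᶜ x ≡ ⟦ χ ⟧ᶜ y) (sym (lookup-index ψ∈L)) (Equivalence.to same-block⇔ e (index ψ∈L))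

    formula-saturated : ∀ φ → Saturated 𝒰 ⟦ φ ⟧ᶜ
    formula-saturated φ {x} {y} e with ψ , ψ∈L , φ⇔ψ ← proj₂ (lt k) φ =
      trans (same-value x) (trans (listed-saturated ψ∈L e) (sym (same-value y)))
      where
      same-value : ∀ z → ⟦ φ ⟧ᶜ z ≡ ⟦ ψ ⟧ᶜ z
      same-value z = Equivalence.to (⟦⇔'⟧≡true⇔ φ ψ z) (φ⇔ψ C C∈𝒜 (block 𝒱) z)

    χ : Fin (Partition.size 𝒰) → Fm n (Fin k)
    χ u = characteristic (lookup L) (λ i → ⟦ lookup L i ⟧ᶜ (representative 𝒰 u))

    χ-defines : ∀ u → ⟦ χ u ⟧ᶜ ≐ block 𝒰 u
    χ-defines u z = ⇔→≡ (mk⇔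
      (λ χz → Equivalence.from (block≡true⇔ 𝒰) (trans
        (Equivalence.from same-block⇔ (Equivalence.to (⟦characteristic⟧≡true⇔ (lookup L) _ z) χz))
        (blk-representative 𝒰 u)))
      (λ z∈u → Equivalence.from (⟦characteristic⟧≡true⇔ (lookup L) _ z) (Equivalence.to same-block⇔
        (trans (Equivalence.to (block≡true⇔ 𝒰) z∈u) (sym (blk-representative 𝒰 u))))))

    tuned : TunedIn C 𝒰
    tuned i = Equivalence.from (tuned⇔saturated 𝒰 (g i)) λ u {x} {y} e → begin
      g i (block 𝒰 u) x  ≡⟨ g-cong i (χ-defines u) x ⟨
      ⟦ ◇ i (χ u) ⟧ᶜ x   ≡⟨ formula-saturated (◇ i (χ u)) e ⟩
      ⟦ ◇ i (χ u) ⟧ᶜ y   ≡⟨ g-cong i (χ-defines u) y ⟩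
      g i (block 𝒰 u) y  ∎
      where open ≡-Reasoning

    tuned-refinement : Σ (Partition X) λ 𝒰 → 𝒰 Refines 𝒱 × Partition.size 𝒰 ≤ tabularity k × TunedIn C 𝒰
    tuned-refinement = 𝒰 , saturated-blocks⇒refines 𝒰 𝒱 (formula-saturated ∘ var) , size≤ , tuned

  tunable : (tabularity -Tunable) 𝒜
  tunable = tuned-refinement

module Tunable⇒LocallyTabular (em : ExcludedMiddle 0ℓ) {ℓ n} {𝒜 : Class ℓ n}
  (f : ℕ → ℕ) (tun : (f -Tunable) 𝒜) (k : ℕ) where

  -- Opaque because unfolding the maximum makes checking the types indexed by models blow up.
  opaque
    bound : ℕ
    bound = max 0 (map f (upTo (suc (2 ^ k))))

    f≤bound : ∀ {j} → j ≤ 2 ^ k → f j ≤ bound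
    f≤bound j≤ = All.lookup (xs≤max 0 _) (∈-map⁺ f (∈-upTo⁺ (s≤s j≤)))

  models : List (PointedModel {n} {k})
  models = pointedModelsUpTo bound

  truthTable : Fm n (Fin k) → Fin (length models) → Bool
  truthTable φ i = evalᵖ φ (lookup models i)

  same-truthTable⇒equivalent : ∀ φ ψ → truthTable φ ≗ truthTable ψ → (φ ⇔' ψ) ∈Log 𝒜
  same-truthTable⇒equivalent φ ψ same C C∈𝒜 val x
    with 𝒰 , 𝒰-refines , size≤f , 𝒰-tuned ← tun C C∈𝒜 (PartitionOf.partition (atoms em val)) =
    Equivalence.from (⟦⇔'⟧≡true⇔ φ ψ x) (begin
      ⟦ φ ⟧ C val x                             ≡⟨ truth φ x ⟩
      evalᵖ φ (_ , quotient C 𝒰 val , blk x)    ≡⟨ agree (∈-pointedModelsUpTo size≤bound _ (blk x)) ⟩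
      evalᵖ ψ (_ , quotient C 𝒰 val , blk x)    ≡⟨ truth ψ x ⟨
      ⟦ ψ ⟧ C val x                             ∎)
    where
    open Semantics C val
    open ≡-Reasoning
    open Partition 𝒰
    open PartitionOf (atoms em val) renaming (partition to 𝒱)

    val-saturated : ∀ j → Saturated 𝒰 (val j)
    val-saturated j e = Equivalence.to same-block⇔ (𝒰-refines _ _ e) j

    truth : ∀ χ x → ⟦ χ ⟧ C val x ≡ eval (quotient C 𝒰 val) χ (blk x)
    truth = quotient-truth C 𝒰 val 𝒰-tuned val-saturated

    size≤bound : size ≤ bound
    size≤bound = ≤-trans size≤f (f≤bound size≤)

    agree : ∀ {pm} → pm ∈ models → evalᵖ φ pm ≡ evalᵖ ψ pm
    agree pm∈ = subst (λ pm → evalᵖ φ pm ≡ evalᵖ ψ pm) (sym (lookup-index pm∈)) (same (index pm∈))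

  locallyTabular : Σ (List (Fm n (Fin k))) λ L →
    ∀ φ → Σ (Fm n (Fin k)) λ ψ → ψ ∈ L × ((φ ⇔' ψ) ∈Log 𝒜)
  locallyTabular with L , covered ← finiteTransversal em (encode ∘ truthTable) =
    L , λ φ → let ψ , ψ∈L , same-code = covered φ
              in  ψ , ψ∈L , same-truthTable⇒equivalent φ ψ (Equivalence.to encode≡⇔ same-code)

theorem4p7 : ExcludedMiddle Level.zero → ∀ {ℓ : Level} (n : ℕ) (𝒜 : Class ℓ n) →
    LocallyTabular 𝒜 ⇔ UniformlyTunable 𝒜
theorem4p7 em n 𝒜 = mk⇔
  (λ lt → tabularity lt , tunable lt)
  (λ (f , tun) k → Tunable⇒LocallyTabular.locallyTabular em f tun k)
  where open LocallyTabular⇒Tunable em
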